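{- Let $a$ be a positive integer, let $r_1, r_2$ be positive integers and $d_1,d_2\in \{0,1,\dots, a-1\}$. Then $\pi_{r_1,d_1}(a) \geq \pi_{r_2, d_2}(a)$ if and only if either $r_1> r_2$, or $r_1=r_2$ and $d_1\leq d_2$.
   Context: A multigraph is a pair $G=(V,w)$ where $V$ is a finite set and $w:\binom{V}{2}\to\mathbb{Z}_{\geq 0}$; $P(G)=\prod_{xy\in\binom{V}{2}}w(xy)$. For positive integers $a,r$, $d\in\{0,\dots,a-1\}$ and $n$, $\mathcal{T}_{r,d}(a,n)$ is the set of multigraphs $G$ on $[n]=\{1,\dots,n\}$ whose vertex set can be partitioned into $r$ parts $V_0,\dots,V_{r-1}$ such that all pairs inside $V_0$ have multiplicity $a-d$, all pairs inside $V_i$ ($1\le i\le r-1$) have multiplicity $a$, and all other pairs have multiplicity $a+1$. $\Pi_{r,d}(a,n)=\max\{P(G):G\in\mathcal{T}_{r,d}(a,n)\}$ and $\pi_{r,d}(a):=\lim_{n\to\infty}\log(\Pi_{r,d}(a,n))/\binom{n}{2}$ (the entropy density). -}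

module Defs where

open import Data.Nat using (ℕ; zero; suc; _+_; _*_; _∸_; _^_; _≤_; _<ᵇ_; _⊔_)
open import Data.Nat.Combinatorics using (_C_)
open import Data.Fin using (Fin; zero; suc; toℕ)
open import Data.Fin.Properties using () renaming (_≟_ to _≟ᶠ_)
open import Data.List using (List; []; _∷_; [_]; map; foldr; concatMap; allFin)
open import Data.Nat.ListAction using (product)
open import Data.Vec using (Vec; []; _∷_; lookup)
open import Data.Product using (_×_; _,_; ∃-syntax)
open import Data.Bool using (if_then_else_)
open import Relation.Nullary using (yes; no)

-- A multigraph on the vertex set [n] (represented as Fin n): a multiplicity
-- function w; only its values on pairs i < j (i.e. on binom([n],2)) matter.
record Multigraph (n : ℕ) : Set where
  constructor mkMG
  field
    w : Fin n → Fin n → ℕ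

pairs : (n : ℕ) → List (Fin n × Fin n)
pairs n = concatMap (λ i → concatMap (λ j → if toℕ i <ᵇ toℕ j then [ (i , j) ] else [])
                                     (allFin n))
                    (allFin n)

P : {n : ℕ} → Multigraph n → ℕ
P {n} G = product (map (λ p → Multigraph.w G (Data.Product.proj₁ p) (Data.Product.proj₂ p)) (pairs n))

-- multiplicity of a pair whose endpoints lie in parts x and y
-- (part 0 is V_0, parts 1..r-1 are V_1..V_{r-1})
partWeight : (a d : ℕ) {r : ℕ} → Fin r → Fin r → ℕ
partWeight a d x y with x ≟ᶠ y
partWeight a d zero    y | yes _ = a ∸ d
partWeight a d (suc _) y | yes _ = a
partWeight a d x       y | no  _ = suc a

-- the multigraph of T_{r,d}(a,n) determined by a partition of [n] into parts
-- V_0..V_{r-1}, given as the function vertex ↦ index of its part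
partitionGraph : (a d r n : ℕ) → Vec (Fin r) n → Multigraph n
partitionGraph a d r n f = mkMG (λ i j → partWeight a d (lookup f i) (lookup f j))

-- all functions [n] → [r] (i.e. all partitions into r labelled, possibly empty, parts)
allLabelings : (r n : ℕ) → List (Vec (Fin r) n)
allLabelings r zero    = [ [] ]
allLabelings r (suc n) = concatMap (λ x → map (x ∷_) (allLabelings r n)) (allFin r)

Π : (r d a n : ℕ) → ℕ
Π r d a n = foldr _⊔_ 0 (map (λ f → P (partitionGraph a d r n f)) (allLabelings r n))

-- π_{r1,d1}(a) ≥ π_{r2,d2}(a), where π_{r,d}(a) = lim log Π_{r,d}(a,n) / binom(n,2).
-- Encoded without reals: for every k ≥ 1, eventually
--   Π_{r2,d2}(a,n)^k ≤ Π_{r1,d1}(a,n)^k · 2^{binom(n,2)},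
-- i.e. log Π₂ / binom(n,2) ≤ log Π₁ / binom(n,2) + (log 2)/k for all large n.
EntropyDensityGeq : (a r₁ d₁ r₂ d₂ : ℕ) → Set
EntropyDensityGeq a r₁ d₁ r₂ d₂ =
  (k : ℕ) → ∃[ n₀ ] ((n : ℕ) → n₀ ≤ n →
     Π r₂ d₂ a n ^ suc k ≤ Π r₁ d₁ a n ^ suc k * 2 ^ (n C 2))

{-# OPTIONS --safe #-}
-- Write Y = a + 1. For a labelling f of [n] whose parts have sizes s₀, …, s_{r−1}, counting the
-- pairs inside and across the parts gives
--   P(f) · Y^(Σᵢ C(sᵢ,2)) = Y^C(n,2) · (a − d)^C(s₀,2) · a^(Σ_{i≥1} C(sᵢ,2)).
-- Relabelling the parts injectively without lowering any inner multiplicity cannot decrease Π, so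
-- Π_{r₂,d₂} ≤ Π_{r₁,d₁} for every n when r₁ = r₂ and d₁ ≤ d₂, or when r₂ < r₁ (through
-- (r₂,d₂) ≤ (r₂,0) ≤ (r₂+1,d₁), the old parts becoming V₁, V₂, …). By the same monotonicity the
-- two remaining cases reduce to π_{R+1,d+1} < π_{R+1,d} for d < a; for r₁ < r₂ one passes
-- through (r₁+1, a), whose part V₀ has multiplicity 0.
-- This strict gap is witnessed along n = 2m + R·q with q = (2a² + 1)·m. If V₀ has at least m
-- vertices, raising its multiplicity from a − d − 1 to a − d gains at least (1 + 1/a)^C(m,2).
-- Otherwise V₁, …, V_R carry at least m + R·q vertices, and the tangent lines of the convex
-- function C(·,2) give Σ_{i≥1} C(sᵢ,2) ≥ R·C(q,2) + q·m; so f loses (Y/a)^(q·m) against the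
-- labelling with |V₀| = 2m and all other parts of size q, which outweighs the cost Y^C(2m,2) of
-- its part V₀. For a suitable constant K both gains exceed 2^(C(n,2)/K).

module Submission where

open import Defs
open import Data.Bool using (Bool; true; false; if_then_else_)
open import Data.Empty using (⊥-elim)
open import Data.Fin using (Fin; zero; suc; toℕ; inject≤) renaming (_≟_ to _≟ᶠ_)
open import Data.Fin.Properties using (inject≤-injective) renaming (suc-injective to sucᶠ-injective)
open import Data.List using (List; []; _∷_; [_]; _++_; map; concat; concatMap; tabulate; allFin)
open import Data.List.Membership.Propositional using (_∈_)
open import Data.List.Membership.Propositional.Properties using (∈-allFin; ∈-map⁺; ∈-concatMap⁺)
open import Data.List.Properties
  using (map-tabulate; concatMap-map; map-concatMap; concatMap-cong; map-++; map-∘; foldr-preservesᵇ; foldr-preservesᵒ)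
open import Data.List.Relation.Unary.All using (universal)
open import Data.List.Relation.Unary.All.Properties using () renaming (map⁺ to All-map⁺)
open import Data.List.Relation.Unary.Any using (here) renaming (map to Any-map)
open import Data.Nat
open import Data.Nat.Combinatorics using (_C_; nC1≡n; nCk+nC[k+1]≡[n+1]C[k+1])
open import Data.Nat.ListAction using (product)
open import Data.Nat.ListAction.Properties using (product-++)
open import Data.Nat.Properties
open import Data.Nat.Tactic.RingSolver using (solve-∀)
open import Data.Product using (_×_; _,_)
import Data.Product as Product
open import Data.Sum using (_⊎_; inj₁; inj₂; [_,_]′)
open import Data.Vec using (Vec; []; _∷_; lookup)
import Data.Vec as Vec
open import Data.Vec.Properties using (lookup-map)
open import Function using (_∘_)
open import Function.Bundles using (_⇔_; mk⇔)
open import Function.Definitions using (Injective)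
open import Relation.Binary.Definitions using (tri<; tri≈; tri>)
open import Relation.Binary.PropositionalEquality hiding ([_])
open import Relation.Nullary using (¬_; Dec; yes; no)

open import Algebra.Properties.Semiring.Sum +-*-semiring
  using (sum-syntax; ∑-distrib-+; sum-cong-≗; sum-replicate-zero; *-distribʳ-sum)


-- Pair counts and exponential estimates

C₂ : ℕ → ℕ
C₂ zero    = 0
C₂ (suc n) = n + C₂ n

C₂≡C2 : ∀ n → C₂ n ≡ n C 2
C₂≡C2 zero    = refl
C₂≡C2 (suc n) = trans (cong₂ _+_ (sym (nC1≡n n)) (C₂≡C2 n)) (nCk+nC[k+1]≡[n+1]C[k+1] n 1)

C₂-mono : ∀ {m n} → m ≤ n → C₂ m ≤ C₂ n
C₂-mono z≤n       = z≤n
C₂-mono (s≤s m≤n) = +-mono-≤ m≤n (C₂-mono m≤n)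

C₂-+ : ∀ m n → C₂ (m + n) ≡ C₂ m + m * n + C₂ n
C₂-+ zero    n = refl
C₂-+ (suc m) n = trans (cong (m + n +_) (C₂-+ m n)) (shuffle m n (C₂ m) (C₂ n))
  where
  shuffle : ∀ m n x y → m + n + (x + m * n + y) ≡ m + x + (n + m * n) + y
  shuffle = solve-∀

2*C₂+n≡n*n : ∀ n → 2 * C₂ n + n ≡ n * n
2*C₂+n≡n*n zero    = refl
2*C₂+n≡n*n (suc n) = trans (shuffle n (C₂ n)) (trans (cong (_+ suc (2 * n)) (2*C₂+n≡n*n n)) (square n))
  where
  shuffle : ∀ n x → 2 * (n + x) + suc n ≡ 2 * x + n + suc (2 * n)
  shuffle = solve-∀
  square : ∀ n → n * n + suc (2 * n) ≡ suc n * suc n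
  square = solve-∀

C₂≤n*n : ∀ n → C₂ n ≤ n * n
C₂≤n*n n = ≤-trans (m≤m+n (C₂ n) (C₂ n + 0))
                   (≤-trans (m≤m+n (2 * C₂ n) n) (≤-reflexive (2*C₂+n≡n*n n)))

C₂<n*n : ∀ {n} → 1 ≤ n → C₂ n < n * n
C₂<n*n {n} 1≤n = ≤-trans (≤-reflexive (+-comm 1 (C₂ n)))
                         (≤-trans (+-mono-≤ (m≤m+n (C₂ n) (C₂ n + 0)) 1≤n) (≤-reflexive (2*C₂+n≡n*n n)))

n*n≤4*C₂ : ∀ {n} → 2 ≤ n → n * n ≤ 4 * C₂ n
n*n≤4*C₂ {n} 2≤n = +-cancelʳ-≤ (2 * n) (n * n) (4 * C₂ n) (begin
  n * n + 2 * n                   ≤⟨ +-monoʳ-≤ (n * n) (*-monoˡ-≤ n 2≤n) ⟩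
  n * n + n * n                   ≡⟨ cong₂ _+_ (2*C₂+n≡n*n n) (2*C₂+n≡n*n n) ⟨
  (2 * C₂ n + n) + (2 * C₂ n + n) ≡⟨ double (C₂ n) n ⟩
  4 * C₂ n + 2 * n                ∎)
  where
  open ≤-Reasoning
  double : ∀ x n → (2 * x + n) + (2 * x + n) ≡ 4 * x + 2 * n
  double = solve-∀

C₂[2*n]≤2*[n*n] : ∀ n → C₂ (2 * n) ≤ 2 * (n * n)
C₂[2*n]≤2*[n*n] n = *-cancelˡ-≤ 2 (≤-trans (m≤m+n (2 * C₂ (2 * n)) (2 * n))
                                           (≤-reflexive (trans (2*C₂+n≡n*n (2 * n)) (square n))))
  where
  square : ∀ n → 2 * n * (2 * n) ≡ 2 * (2 * (n * n))
  square = solve-∀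

C₂-tangent : ∀ k s → C₂ k + k * s ≤ C₂ s + k * k
C₂-tangent k s with ≤-total k s
... | inj₁ k≤s = subst (λ s → C₂ k + k * s ≤ C₂ s + k * k) (m+[n∸m]≡n k≤s) (above (s ∸ k))
  where
  above : ∀ e → C₂ k + k * (k + e) ≤ C₂ (k + e) + k * k
  above e = begin
    C₂ k + k * (k + e)               ≤⟨ m≤m+n _ (C₂ e) ⟩
    C₂ k + k * (k + e) + C₂ e        ≡⟨ shuffle (C₂ k) k e (C₂ e) ⟩
    C₂ k + k * e + C₂ e + k * k      ≡⟨ cong (_+ k * k) (C₂-+ k e) ⟨
    C₂ (k + e) + k * k               ∎
    where
    open ≤-Reasoning
    shuffle : ∀ x k e y → x + k * (k + e) + y ≡ x + k * e + y + k * k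
    shuffle = solve-∀
... | inj₂ s≤k = subst (λ k → C₂ k + k * s ≤ C₂ s + k * k) (m+[n∸m]≡n s≤k) (below (k ∸ s))
  where
  below : ∀ e → C₂ (s + e) + (s + e) * s ≤ C₂ s + (s + e) * (s + e)
  below e = begin
    C₂ (s + e) + (s + e) * s          ≡⟨ cong (_+ (s + e) * s) (C₂-+ s e) ⟩
    C₂ s + s * e + C₂ e + (s + e) * s ≤⟨ +-monoˡ-≤ ((s + e) * s) (+-monoʳ-≤ (C₂ s + s * e) (C₂≤n*n e)) ⟩
    C₂ s + s * e + e * e + (s + e) * s ≡⟨ shuffle (C₂ s) s e ⟩
    C₂ s + (s + e) * (s + e)          ∎
    where
    open ≤-Reasoning
    shuffle : ∀ x s e → x + s * e + e * e + (s + e) * s ≡ x + (s + e) * (s + e)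
    shuffle = solve-∀

^-distribʳ-* : ∀ m n k → (m * n) ^ k ≡ m ^ k * n ^ k
^-distribʳ-* m n zero    = refl
^-distribʳ-* m n (suc k) =
  trans (cong (m * n *_) (^-distribʳ-* m n k)) ([m*n]*[o*p]≡[m*o]*[n*p] m n (m ^ k) (n ^ k))

1+n≤2^n : ∀ n → suc n ≤ 2 ^ n
1+n≤2^n zero    = ≤-refl
1+n≤2^n (suc n) = ≤-trans (≤-reflexive (+-comm 1 (suc n)))
                          (+-mono-≤ (1+n≤2^n n) (≤-trans (m^n>0 2 n) (m≤m+n (2 ^ n) 0)))

bernoulli : ∀ m k → m ^ suc k + suc k * m ^ k ≤ suc m ^ suc k
bernoulli m zero    = ≤-reflexive (base m)
  where
  base : ∀ m → m * 1 + 1 * 1 ≡ suc m * 1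
  base = solve-∀
bernoulli m (suc k) = begin
  m * (m * m ^ k) + suc (suc k) * (m * m ^ k)                ≤⟨ m≤m+n _ (suc k * m ^ k) ⟩
  m * (m * m ^ k) + suc (suc k) * (m * m ^ k) + suc k * m ^ k ≡⟨ factor m k (m ^ k) ⟩
  suc m * (m * m ^ k + suc k * m ^ k)                        ≤⟨ *-monoʳ-≤ (suc m) (bernoulli m k) ⟩
  suc m * suc m ^ suc k                                      ∎
  where
  open ≤-Reasoning
  factor : ∀ m k x → m * (m * x) + (2 + k) * (m * x) + (1 + k) * x ≡ (1 + m) * (m * x + (1 + k) * x)
  factor = solve-∀

2*m^n≤[1+m]^n : ∀ {m n} → m ≤ n → 1 ≤ n → 2 * m ^ n ≤ suc m ^ n
2*m^n≤[1+m]^n {m} {suc k} m≤n _ = begin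
  2 * (m * m ^ k)           ≡⟨ cong (m * m ^ k +_) (+-identityʳ (m * m ^ k)) ⟩
  m * m ^ k + m * m ^ k     ≤⟨ +-monoʳ-≤ (m * m ^ k) (*-monoˡ-≤ (m ^ k) m≤n) ⟩
  m ^ suc k + suc k * m ^ k ≤⟨ bernoulli m k ⟩
  suc m ^ suc k             ∎
  where open ≤-Reasoning

2^j*m^o≤[1+m]^o : ∀ {m n j o} → m ≤ n → 1 ≤ n → n * j ≤ o → 2 ^ j * m ^ o ≤ suc m ^ o
2^j*m^o≤[1+m]^o {m} {n} {j} {o} m≤n 1≤n n*j≤o =
  subst (λ o → 2 ^ j * m ^ o ≤ suc m ^ o) (m+[n∸m]≡n n*j≤o) (split (o ∸ n * j))
  where
  open ≤-Reasoning
  split : ∀ e → 2 ^ j * m ^ (n * j + e) ≤ suc m ^ (n * j + e)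
  split e = begin
    2 ^ j * m ^ (n * j + e)           ≡⟨ cong (2 ^ j *_) (^-distribˡ-+-* m (n * j) e) ⟩
    2 ^ j * (m ^ (n * j) * m ^ e)     ≡⟨ cong (λ x → 2 ^ j * (x * m ^ e)) (^-*-assoc m n j) ⟨
    2 ^ j * ((m ^ n) ^ j * m ^ e)     ≡⟨ *-assoc (2 ^ j) _ _ ⟨
    2 ^ j * (m ^ n) ^ j * m ^ e       ≡⟨ cong (_* m ^ e) (^-distribʳ-* 2 (m ^ n) j) ⟨
    (2 * m ^ n) ^ j * m ^ e           ≤⟨ *-mono-≤ (^-monoˡ-≤ j (2*m^n≤[1+m]^n m≤n 1≤n)) (^-monoˡ-≤ e (n≤1+n m)) ⟩
    (suc m ^ n) ^ j * suc m ^ e       ≡⟨ cong (_* suc m ^ e) (^-*-assoc (suc m) n j) ⟩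
    suc m ^ (n * j) * suc m ^ e       ≡⟨ ^-distribˡ-+-* (suc m) (n * j) e ⟨
    suc m ^ (n * j + e)               ∎

exponential-gap : ∀ {a c T F E} → 1 ≤ a → c ≤ a → a * (suc T + a * F) ≤ E →
  c ^ E * suc c ^ F * 2 ^ T < suc c ^ E
exponential-gap {a} {c} {T} {F} {E} 1≤a c≤a bound = half (m^n>0 (suc c) E) (begin
  2 * (c ^ E * suc c ^ F * 2 ^ T)          ≤⟨ *-monoʳ-≤ 2 (*-monoˡ-≤ (2 ^ T) (*-monoʳ-≤ (c ^ E) [1+c]^F≤2^[a*F])) ⟩
  2 * (c ^ E * 2 ^ (a * F) * 2 ^ T)        ≡⟨ shuffle (c ^ E) (2 ^ (a * F)) (2 ^ T) ⟩
  2 * (2 ^ T * 2 ^ (a * F)) * c ^ E        ≡⟨ cong (λ x → 2 * x * c ^ E) (^-distribˡ-+-* 2 T (a * F)) ⟨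
  2 ^ (suc T + a * F) * c ^ E              ≤⟨ 2^j*m^o≤[1+m]^o c≤a 1≤a bound ⟩
  suc c ^ E                                ∎)
  where
  open ≤-Reasoning
  half : ∀ {x y} → 0 < y → 2 * x ≤ y → x < y
  half {zero}  0<y _   = 0<y
  half {suc x} _   2x≤y = <-≤-trans (m<m+n (suc x) z<s) 2x≤y
  [1+c]^F≤2^[a*F] : suc c ^ F ≤ 2 ^ (a * F)
  [1+c]^F≤2^[a*F] = ≤-trans (^-monoˡ-≤ F (≤-trans (s≤s c≤a) (1+n≤2^n a))) (≤-reflexive (^-*-assoc 2 a F))
  shuffle : ∀ x y z → 2 * (x * y * z) ≡ 2 * (z * y) * x
  shuffle = solve-∀


∑-const : ∀ n c → ∑[ i < n ] c ≡ n * c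
∑-const zero    c = refl
∑-const (suc n) c = cong (c +_) (∑-const n c)

∑-C₂-tangent : ∀ {r} q (s : Fin r → ℕ) → r * C₂ q + q * ∑[ i < r ] s i ≤ ∑[ i < r ] C₂ (s i) + r * (q * q)
∑-C₂-tangent {zero}  q s = ≤-reflexive (*-zeroʳ q)
∑-C₂-tangent {suc r} q s = begin
  suc r * C₂ q + q * (s zero + S)                 ≡⟨ shuffleˡ (C₂ q) q (s zero) r S ⟩
  (C₂ q + q * s zero) + (r * C₂ q + q * S)         ≤⟨ +-mono-≤ (C₂-tangent q (s zero)) (∑-C₂-tangent q (s ∘ suc)) ⟩
  (C₂ (s zero) + q * q) + (∑C₂ + r * (q * q))      ≡⟨ shuffleʳ (C₂ (s zero)) (q * q) ∑C₂ r ⟩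
  C₂ (s zero) + ∑C₂ + suc r * (q * q)              ∎
  where
  open ≤-Reasoning
  S ∑C₂ : ℕ
  S = ∑[ i < r ] s (suc i)
  ∑C₂ = ∑[ i < r ] C₂ (s (suc i))
  shuffleˡ : ∀ c q x r S → suc r * c + q * (x + S) ≡ (c + q * x) + (r * c + q * S)
  shuffleˡ = solve-∀
  shuffleʳ : ∀ y p z r → (y + p) + (z + r * p) ≡ y + z + suc r * p
  shuffleʳ = solve-∀

δ : ∀ {r} → Fin r → Fin r → ℕ
δ zero    zero    = 1
δ zero    (suc _) = 0
δ (suc _) zero    = 0
δ (suc i) (suc j) = δ i j

δ-refl : ∀ {r} (i : Fin r) → δ i i ≡ 1
δ-refl zero    = refl
δ-refl (suc i) = δ-refl i

δ-≢ : ∀ {r} {i j : Fin r} → i ≢ j → δ i j ≡ 0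
δ-≢ {i = zero}  {zero}  i≢j = ⊥-elim (i≢j refl)
δ-≢ {i = zero}  {suc j} i≢j = refl
δ-≢ {i = suc i} {zero}  i≢j = refl
δ-≢ {i = suc i} {suc j} i≢j = δ-≢ (i≢j ∘ cong suc)

∑-δˡ : ∀ {r} (j : Fin r) → ∑[ i < r ] δ i j ≡ 1
∑-δˡ {suc r} zero    = cong suc (sum-replicate-zero r)
∑-δˡ {suc r} (suc j) = ∑-δˡ j

∑-δʳ : ∀ {r} (i : Fin r) → ∑[ j < r ] δ i j ≡ 1
∑-δʳ {suc r} zero    = cong suc (sum-replicate-zero r)
∑-δʳ {suc r} (suc i) = ∑-δʳ i

∑-C₂-bump : ∀ {r} (j : Fin r) (h : Fin r → ℕ) → ∑[ i < r ] C₂ (δ i j + h i) ≡ h j + ∑[ i < r ] C₂ (h i)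
∑-C₂-bump {suc r} zero    h = +-assoc (h zero) _ _
∑-C₂-bump {suc r} (suc j) h = trans (cong (C₂ (h zero) +_) (∑-C₂-bump j (h ∘ suc)))
                                    (x+[y+z]≡y+[x+z] (C₂ (h zero)) (h (suc j)) _)
  where
  x+[y+z]≡y+[x+z] : ∀ x y z → x + (y + z) ≡ y + (x + z)
  x+[y+z]≡y+[x+z] = solve-∀


-- Products over the pairs of [n]

map-if-[-] : ∀ {A B : Set} (f : A → B) (b : Bool) (x : A) →
  map f (if b then [ x ] else []) ≡ (if b then [ f x ] else [])
map-if-[-] f true  x = refl
map-if-[-] f false x = refl

concat-tabulate-[-] : ∀ {A : Set} {n} (h : Fin n → A) → concat (tabulate (λ j → [ h j ])) ≡ tabulate h
concat-tabulate-[-] {n = zero}  h = refl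
concat-tabulate-[-] {n = suc n} h = cong (h zero ∷_) (concat-tabulate-[-] (h ∘ suc))

tabulate-suc : ∀ n → tabulate {A = Fin (suc n)} suc ≡ map suc (allFin n)
tabulate-suc n = sym (map-tabulate (λ i → i) suc)

pairs-suc : ∀ n → pairs (suc n) ≡ tabulate (λ j → zero , suc j) ++ map (Product.map suc suc) (pairs n)
pairs-suc n = cong₂ _++_ (trans (cong concat (map-tabulate {A = Fin (suc n)} suc _)) (concat-tabulate-[-] _)) shifted
  where
  open ≡-Reasoning
  φ : Fin n × Fin n → Fin (suc n) × Fin (suc n)
  φ = Product.map suc suc
  cell : ∀ {N} → Fin N → Fin N → List (Fin N × Fin N)
  cell i j = if toℕ i <ᵇ toℕ j then [ (i , j) ] else []
  row : ∀ {N} → Fin N → List (Fin N × Fin N)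
  row {N} i = concatMap (cell i) (allFin N)
  row-suc : ∀ i → row (suc i) ≡ map φ (row i)
  row-suc i = begin
    concatMap (cell (suc i)) (tabulate suc)       ≡⟨ cong (concatMap (cell (suc i))) (tabulate-suc n) ⟩
    concatMap (cell (suc i)) (map suc (allFin n)) ≡⟨ concatMap-map (cell (suc i)) suc (allFin n) ⟩
    concatMap (cell (suc i) ∘ suc) (allFin n)
      ≡⟨ concatMap-cong (λ j → sym (map-if-[-] φ (toℕ i <ᵇ toℕ j) (i , j))) (allFin n) ⟩
    concatMap (map φ ∘ cell i) (allFin n)         ≡⟨ map-concatMap φ (cell i) (allFin n) ⟨
    map φ (row i)                                 ∎
  shifted : concatMap row (tabulate suc) ≡ map φ (pairs n)
  shifted = begin
    concatMap row (tabulate suc)       ≡⟨ cong (concatMap row) (tabulate-suc n) ⟩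
    concatMap row (map suc (allFin n)) ≡⟨ concatMap-map row suc (allFin n) ⟩
    concatMap (row ∘ suc) (allFin n)   ≡⟨ concatMap-cong row-suc (allFin n) ⟩
    concatMap (map φ ∘ row) (allFin n) ≡⟨ map-concatMap φ row (allFin n) ⟨
    map φ (pairs n)                    ∎

P-suc : ∀ {n} (w : Fin (suc n) → Fin (suc n) → ℕ) →
  P (mkMG w) ≡ product (tabulate (λ j → w zero (suc j))) * P (mkMG (λ i j → w (suc i) (suc j)))
P-suc {n} w = begin
  product (map g (pairs (suc n)))                            ≡⟨ cong (product ∘ map g) (pairs-suc n) ⟩
  product (map g (first ++ map φ (pairs n)))                 ≡⟨ cong product (map-++ g first (map φ (pairs n))) ⟩
  product (map g first ++ map g (map φ (pairs n)))           ≡⟨ product-++ (map g first) (map g (map φ (pairs n))) ⟩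
  product (map g first) * product (map g (map φ (pairs n)))
    ≡⟨ cong₂ (λ u v → product u * product v) (map-tabulate (λ j → zero , suc j) g) (sym (map-∘ {g = g} {f = φ} (pairs n))) ⟩
  product (tabulate (λ j → w zero (suc j))) * P (mkMG (λ i j → w (suc i) (suc j))) ∎
  where
  open ≡-Reasoning
  g : Fin (suc n) × Fin (suc n) → ℕ
  g (i , j) = w i j
  φ : Fin n × Fin n → Fin (suc n) × Fin (suc n)
  φ = Product.map suc suc
  first : List (Fin (suc n) × Fin (suc n))
  first = tabulate (λ j → zero , suc j)

product-map-mono : ∀ {A : Set} {g h : A → ℕ} → (∀ x → g x ≤ h x) → ∀ xs → product (map g xs) ≤ product (map h xs)
product-map-mono g≤h []       = ≤-refl
product-map-mono g≤h (x ∷ xs) = *-mono-≤ (g≤h x) (product-map-mono g≤h xs)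

P-mono : ∀ {n} {w w′ : Fin n → Fin n → ℕ} → (∀ i j → w i j ≤ w′ i j) → P (mkMG w) ≤ P (mkMG w′)
P-mono {n} w≤w′ = product-map-mono (λ (i , j) → w≤w′ i j) (pairs n)


-- Part sizes of a labelling

size : ∀ {r n} → Vec (Fin r) n → Fin r → ℕ
size []      i = 0
size (y ∷ f) i = δ i y + size f i

∑-size : ∀ {r n} (f : Vec (Fin r) n) → ∑[ i < r ] size f i ≡ n
∑-size {r} []      = sum-replicate-zero r
∑-size {r} (y ∷ f) = trans (∑-distrib-+ (λ i → δ i y) (size f)) (cong₂ _+_ (∑-δˡ y) (∑-size f))

size-++ : ∀ {r m n} (u : Vec (Fin r) m) (v : Vec (Fin r) n) i → size (u Vec.++ v) i ≡ size u i + size v i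
size-++ []      v i = refl
size-++ (y ∷ u) v i = trans (cong (δ i y +_) (size-++ u v i)) (sym (+-assoc (δ i y) _ _))

size-replicate : ∀ {r} k (x : Fin r) i → size (Vec.replicate k x) i ≡ δ i x * k
size-replicate zero    x i = sym (*-zeroʳ (δ i x))
size-replicate (suc k) x i = trans (cong (δ i x +_) (size-replicate k x i)) (sym (*-suc (δ i x) k))

size-concat : ∀ {r m} n (h : Fin n → Vec (Fin r) m) i → size (Vec.concat (Vec.tabulate h)) i ≡ ∑[ j < n ] size (h j) i
size-concat zero    h i = refl
size-concat (suc n) h i = trans (size-++ (h zero) _ i) (cong (size (h zero) i +_) (size-concat n (h ∘ suc) i))

balanced : ∀ R t q → Vec (Fin (suc R)) (t + R * q)
balanced R t q = Vec.replicate t zero Vec.++ Vec.concat (Vec.tabulate (λ i → Vec.replicate q (suc i)))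

size-balanced : ∀ R t q i → size (balanced R t q) i ≡ δ i zero * t + (∑[ j < R ] δ i (suc j)) * q
size-balanced R t q i = begin
  size (balanced R t q) i                                          ≡⟨ size-++ (Vec.replicate t zero) _ i ⟩
  size (Vec.replicate t zero) i + size (Vec.concat (Vec.tabulate blocks)) i
    ≡⟨ cong₂ _+_ (size-replicate t zero i) (size-concat R blocks i) ⟩
  δ i zero * t + ∑[ j < R ] size (blocks j) i                      ≡⟨ cong (δ i zero * t +_) (sum-cong-≗ (λ j → size-replicate q (suc j) i)) ⟩
  δ i zero * t + ∑[ j < R ] (δ i (suc j) * q)                      ≡⟨ cong (δ i zero * t +_) (*-distribʳ-sum q (λ j → δ i (suc j))) ⟨
  δ i zero * t + (∑[ j < R ] δ i (suc j)) * q                      ∎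
  where
  open ≡-Reasoning
  blocks : Fin R → Vec (Fin (suc R)) q
  blocks j = Vec.replicate q (suc j)

size-balanced-zero : ∀ R t q → size (balanced R t q) zero ≡ t
size-balanced-zero R t q =
  trans (size-balanced R t q zero) (trans (cong (λ x → 1 * t + x * q) (sum-replicate-zero R)) (trans (+-identityʳ (1 * t)) (*-identityˡ t)))

size-balanced-suc : ∀ R t q i → size (balanced R t q) (suc i) ≡ q
size-balanced-suc R t q i = trans (size-balanced R t q (suc i)) (trans (cong (_* q) (∑-δʳ i)) (*-identityˡ q))

insidePairs⁺ : ∀ {R n} → Vec (Fin (suc R)) n → ℕ
insidePairs⁺ {R} f = ∑[ i < R ] C₂ (size f (suc i))

-- Definitionally C₂ (size f zero) + insidePairs⁺ f.
insidePairs : ∀ {R n} → Vec (Fin (suc R)) n → ℕ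
insidePairs {R} f = ∑[ i < suc R ] C₂ (size f i)

insidePairs⁺-balanced : ∀ R t q → insidePairs⁺ (balanced R t q) ≡ R * C₂ q
insidePairs⁺-balanced R t q = trans (sum-cong-≗ (λ i → cong C₂ (size-balanced-suc R t q i))) (∑-const R (C₂ q))


-- The product formula for partition multigraphs

Pf : (a d : ℕ) {r n : ℕ} → Vec (Fin r) n → ℕ
Pf a d {r} {n} f = P (partitionGraph a d r n f)

rowProduct : (a d : ℕ) {r n : ℕ} → Fin r → Vec (Fin r) n → ℕ
rowProduct a d x f = product (tabulate (λ j → partWeight a d x (lookup f j)))

Pf-∷ : ∀ a d {r n} (x : Fin r) (f : Vec (Fin r) n) → Pf a d (x ∷ f) ≡ rowProduct a d x f * Pf a d f
Pf-∷ a d {r} {n} x f = P-suc (Multigraph.w (partitionGraph a d r (suc n) (x ∷ f)))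

innerWeight : (a d : ℕ) {r : ℕ} → Fin r → ℕ
innerWeight a d zero    = a ∸ d
innerWeight a d (suc _) = a

partWeight-≡ : ∀ a d {r} (i : Fin r) → partWeight a d i i ≡ innerWeight a d i
partWeight-≡ a d i with i ≟ᶠ i
partWeight-≡ a d zero    | yes _ = refl
partWeight-≡ a d (suc _) | yes _ = refl
...                      | no i≢i = ⊥-elim (i≢i refl)

partWeight-≢ : ∀ a d {r} {i j : Fin r} → i ≢ j → partWeight a d i j ≡ suc a
partWeight-≢ a d {i = i} {j} i≢j with i ≟ᶠ j
...                               | yes i≡j = ⊥-elim (i≢j i≡j)
partWeight-≢ a d {i = zero}  i≢j | no _ = refl
partWeight-≢ a d {i = suc _} i≢j | no _ = refl

partWeight-δ : ∀ a d {r} (i j : Fin r) → partWeight a d i j * suc a ^ δ i j ≡ innerWeight a d i ^ δ i j * suc a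
partWeight-δ a d i j = by-cases (i ≟ᶠ j)
  where
  by-cases : Dec (i ≡ j) → partWeight a d i j * suc a ^ δ i j ≡ innerWeight a d i ^ δ i j * suc a
  by-cases (yes refl) rewrite partWeight-≡ a d i | δ-refl i = comm (innerWeight a d i) (suc a)
    where
    comm : ∀ x y → x * (y * 1) ≡ x * 1 * y
    comm = solve-∀
  by-cases (no i≢j) rewrite partWeight-≢ a d i≢j | δ-≢ i≢j = trans (*-identityʳ (suc a)) (sym (*-identityˡ (suc a)))

row-formula : ∀ a d {r n} (x : Fin r) (f : Vec (Fin r) n) →
  rowProduct a d x f * suc a ^ size f x ≡ innerWeight a d x ^ size f x * suc a ^ n
row-formula a d x []      = refl
row-formula a d {n = suc n} x (y ∷ f) = begin
  p * ρ * Y ^ (e + s)           ≡⟨ cong (p * ρ *_) (^-distribˡ-+-* Y e s) ⟩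
  p * ρ * (Y ^ e * Y ^ s)       ≡⟨ [m*n]*[o*p]≡[m*o]*[n*p] p ρ (Y ^ e) (Y ^ s) ⟩
  p * Y ^ e * (ρ * Y ^ s)       ≡⟨ cong₂ _*_ (partWeight-δ a d x y) (row-formula a d x f) ⟩
  w ^ e * Y * (w ^ s * Y ^ n)   ≡⟨ [m*n]*[o*p]≡[m*o]*[n*p] (w ^ e) Y (w ^ s) (Y ^ n) ⟩
  w ^ e * w ^ s * (Y * Y ^ n)   ≡⟨ cong (_* (Y * Y ^ n)) (^-distribˡ-+-* w e s) ⟨
  w ^ (e + s) * Y ^ suc n       ∎
  where
  open ≡-Reasoning
  Y = suc a
  w = innerWeight a d x
  p = partWeight a d x y
  ρ = rowProduct a d x f
  e = δ x y
  s = size f x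

insideProduct : (a d : ℕ) {R n : ℕ} → Vec (Fin (suc R)) n → ℕ
insideProduct a d f = (a ∸ d) ^ C₂ (size f zero) * a ^ insidePairs⁺ f

insideProduct-∷ : ∀ a d {R n} (x : Fin (suc R)) (f : Vec (Fin (suc R)) n) →
  insideProduct a d (x ∷ f) ≡ innerWeight a d x ^ size f x * insideProduct a d f
insideProduct-∷ a d zero f = trans (cong (_* a ^ insidePairs⁺ f) (^-distribˡ-+-* (a ∸ d) (size f zero) _))
                                   (*-assoc ((a ∸ d) ^ size f zero) _ _)
insideProduct-∷ a d (suc j) f = trans (cong (λ e → (a ∸ d) ^ C₂ (size f zero) * a ^ e) (∑-C₂-bump j (size f ∘ suc)))
                                (trans (cong ((a ∸ d) ^ C₂ (size f zero) *_) (^-distribˡ-+-* a (size f (suc j)) _))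
                                       (x*[y*z]≡y*[x*z] ((a ∸ d) ^ C₂ (size f zero)) (a ^ size f (suc j)) (a ^ insidePairs⁺ f)))
  where
  x*[y*z]≡y*[x*z] : ∀ x y z → x * (y * z) ≡ y * (x * z)
  x*[y*z]≡y*[x*z] = solve-∀

P-formula : ∀ a d {R n} (f : Vec (Fin (suc R)) n) →
  Pf a d f * suc a ^ insidePairs f ≡ suc a ^ C₂ n * insideProduct a d f
P-formula a d {R} []      rewrite sum-replicate-zero R = refl
P-formula a d {R} {suc n} (x ∷ f) = begin
  Pf a d (x ∷ f) * Y ^ insidePairs (x ∷ f)     ≡⟨ cong₂ (λ p e → p * Y ^ e) (Pf-∷ a d x f) (∑-C₂-bump x (size f)) ⟩
  ρ * Pf a d f * Y ^ (s + insidePairs f)       ≡⟨ cong (ρ * Pf a d f *_) (^-distribˡ-+-* Y s _) ⟩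
  ρ * Pf a d f * (Y ^ s * Y ^ insidePairs f)   ≡⟨ [m*n]*[o*p]≡[m*o]*[n*p] ρ (Pf a d f) (Y ^ s) _ ⟩
  ρ * Y ^ s * (Pf a d f * Y ^ insidePairs f)   ≡⟨ cong₂ _*_ (row-formula a d x f) (P-formula a d f) ⟩
  w ^ s * Y ^ n * (Y ^ C₂ n * insideProduct a d f) ≡⟨ shuffle (w ^ s) (Y ^ n) (Y ^ C₂ n) _ ⟩
  Y ^ n * Y ^ C₂ n * (w ^ s * insideProduct a d f) ≡⟨ cong₂ _*_ (^-distribˡ-+-* Y n (C₂ n)) (insideProduct-∷ a d x f) ⟨
  Y ^ C₂ (suc n) * insideProduct a d (x ∷ f)   ∎
  where
  open ≡-Reasoning
  Y = suc a
  w = innerWeight a d x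
  ρ = rowProduct a d x f
  s = size f x
  shuffle : ∀ p q r t → p * q * (r * t) ≡ q * r * (p * t)
  shuffle = solve-∀

P-upper : ∀ a d {R n} (f : Vec (Fin (suc R)) n) → Pf a d f * suc a ^ insidePairs⁺ f ≤ suc a ^ C₂ n * a ^ insidePairs⁺ f
P-upper a d {n = n} f = *-cancelʳ-≤ _ _ (Y ^ t) {{m^n≢0 Y t}} (begin
  Pf a d f * Y ^ A * Y ^ t         ≡⟨ shuffle (Pf a d f) (Y ^ A) (Y ^ t) ⟩
  Pf a d f * (Y ^ t * Y ^ A)       ≡⟨ cong (Pf a d f *_) (^-distribˡ-+-* Y t A) ⟨
  Pf a d f * Y ^ insidePairs f     ≡⟨ P-formula a d f ⟩
  Y ^ C₂ n * ((a ∸ d) ^ t * a ^ A) ≤⟨ *-monoʳ-≤ (Y ^ C₂ n) (*-monoˡ-≤ (a ^ A) (^-monoˡ-≤ t (≤-trans (m∸n≤m a d) (n≤1+n a)))) ⟩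
  Y ^ C₂ n * (Y ^ t * a ^ A)       ≡⟨ shuffle (Y ^ C₂ n) (a ^ A) (Y ^ t) ⟨
  Y ^ C₂ n * a ^ A * Y ^ t         ∎)
  where
  open ≤-Reasoning
  Y = suc a
  t = C₂ (size f zero)
  A = insidePairs⁺ f
  shuffle : ∀ x y z → x * y * z ≡ x * (z * y)
  shuffle = solve-∀

P-lower : ∀ a d {R n} → d < a → (f : Vec (Fin (suc R)) n) →
  suc a ^ C₂ n * a ^ insidePairs⁺ f ≤ Pf a d f * suc a ^ insidePairs f
P-lower a d {n = n} d<a f = begin
  suc a ^ C₂ n * a ^ A                          ≤⟨ *-monoʳ-≤ (suc a ^ C₂ n) (m≤n*m (a ^ A) (b ^ t) {{m^n≢0 b t {{b≢0}}}}) ⟩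
  suc a ^ C₂ n * insideProduct a d f            ≡⟨ P-formula a d f ⟨
  Pf a d f * suc a ^ insidePairs f              ∎
  where
  open ≤-Reasoning
  A = insidePairs⁺ f
  b = a ∸ d
  t = C₂ (size f zero)
  b≢0 : NonZero b
  b≢0 = >-nonZero (m<n⇒0<n∸m d<a)


-- Π as a maximum over labellings

∈-allLabelings : ∀ {r n} (f : Vec (Fin r) n) → f ∈ allLabelings r n
∈-allLabelings []      = here refl
∈-allLabelings (x ∷ f) = ∈-concatMap⁺ _ (Any-map (λ { refl → ∈-map⁺ (x ∷_) (∈-allLabelings f) }) (∈-allFin x))

Pf≤Π : ∀ a d {r n} (f : Vec (Fin r) n) → Pf a d f ≤ Π r d a n
Pf≤Π a d {r} {n} f = foldr-preservesᵒ ⊔-upper 0 (map (Pf a d) (allLabelings r n))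
                                      (inj₂ (Any-map ≤-reflexive (∈-map⁺ (Pf a d) (∈-allLabelings f))))
  where
  ⊔-upper : ∀ x y → Pf a d f ≤ x ⊎ Pf a d f ≤ y → Pf a d f ≤ x ⊔ y
  ⊔-upper x y = [ m≤n⇒m≤n⊔o y , m≤n⇒m≤o⊔n x ]′

Π-induction : ∀ a d r n (Q : ℕ → Set) → Q 0 → (∀ f → Q (Pf a d f)) → Q (Π r d a n)
Π-induction a d r n Q Q0 QPf = foldr-preservesᵇ {P = Q} ⊔-closed Q0 (All-map⁺ (universal QPf (allLabelings r n)))
  where
  ⊔-closed : ∀ {x y} → Q x → Q y → Q (x ⊔ y)
  ⊔-closed {x} {y} Qx Qy = [ (λ x⊔y≡x → subst Q (sym x⊔y≡x) Qx) , (λ x⊔y≡y → subst Q (sym x⊔y≡y) Qy) ]′ (⊔-sel x y)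

partWeight-relabel : ∀ a {d d′ r r′} (φ : Fin r → Fin r′) → Injective _≡_ _≡_ φ →
  (∀ i → innerWeight a d i ≤ innerWeight a d′ (φ i)) → ∀ i j → partWeight a d i j ≤ partWeight a d′ (φ i) (φ j)
partWeight-relabel a {d} {d′} φ φ-inj w≤ i j = by-cases (i ≟ᶠ j)
  where
  by-cases : Dec (i ≡ j) → partWeight a d i j ≤ partWeight a d′ (φ i) (φ j)
  by-cases (yes refl) = subst₂ _≤_ (sym (partWeight-≡ a d i)) (sym (partWeight-≡ a d′ (φ i))) (w≤ i)
  by-cases (no i≢j)   = ≤-reflexive (trans (partWeight-≢ a d i≢j) (sym (partWeight-≢ a d′ (i≢j ∘ φ-inj))))

Π-relabel : ∀ a {d d′ r r′} n (φ : Fin r → Fin r′) → Injective _≡_ _≡_ φ →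
  (∀ i → innerWeight a d i ≤ innerWeight a d′ (φ i)) → Π r d a n ≤ Π r′ d′ a n
Π-relabel a {d} {d′} {r} {r′} n φ φ-inj w≤ = Π-induction a d r n (_≤ Π r′ d′ a n) z≤n λ f →
  ≤-trans (P-mono (λ i j → subst₂ (λ x y → partWeight a d (lookup f i) (lookup f j) ≤ partWeight a d′ x y)
                                  (sym (lookup-map i φ f)) (sym (lookup-map j φ f))
                                  (partWeight-relabel a φ φ-inj w≤ (lookup f i) (lookup f j))))
          (Pf≤Π a d′ (Vec.map φ f))

Π-antitone-d : ∀ a r n {d d′} → d′ ≤ d → Π r d a n ≤ Π r d′ a n
Π-antitone-d a r n {d} {d′} d′≤d = Π-relabel a n (λ i → i) (λ i≡j → i≡j) w≤
  where
  w≤ : ∀ {r} (i : Fin r) → innerWeight a d i ≤ innerWeight a d′ i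
  w≤ zero    = ∸-monoʳ-≤ a d′≤d
  w≤ (suc _) = ≤-refl

Π-mono-r : ∀ a d n {r r′} → r ≤ r′ → Π r d a n ≤ Π r′ d a n
Π-mono-r a d n r≤r′ = Π-relabel a n (λ i → inject≤ i r≤r′) (inject≤-injective r≤r′ r≤r′ _ _) (w≤ r≤r′)
  where
  w≤ : ∀ {r r′} (r≤r′ : r ≤ r′) (i : Fin r) → innerWeight a d i ≤ innerWeight a d (inject≤ i r≤r′)
  w≤ (s≤s _) zero    = ≤-refl
  w≤ (s≤s _) (suc _) = ≤-refl

Π-shift : ∀ a d r n → Π r 0 a n ≤ Π (suc r) d a n
Π-shift a d r n = Π-relabel a n suc sucᶠ-injective w≤
  where
  w≤ : ∀ {r} (i : Fin r) → innerWeight a 0 i ≤ innerWeight a d (suc i)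
  w≤ zero    = ≤-refl
  w≤ (suc _) = ≤-refl

Π-mono-order : ∀ a n {r₁ r₂ d₁ d₂} → r₂ < r₁ ⊎ (r₁ ≡ r₂ × d₁ ≤ d₂) → Π r₂ d₂ a n ≤ Π r₁ d₁ a n
Π-mono-order a n {r₁} {r₂} {d₁} {d₂} (inj₁ r₂<r₁) = begin
  Π r₂ d₂ a n       ≤⟨ Π-antitone-d a r₂ n z≤n ⟩
  Π r₂ 0 a n        ≤⟨ Π-shift a d₁ r₂ n ⟩
  Π (suc r₂) d₁ a n ≤⟨ Π-mono-r a d₁ n r₂<r₁ ⟩
  Π r₁ d₁ a n       ∎
  where open ≤-Reasoning
Π-mono-order a n {r₁} (inj₂ (refl , d₁≤d₂)) = Π-antitone-d a r₁ n d₁≤d₂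


-- Separation of entropy densities

EntropyDensityGeq-of-≤ : ∀ a {r₁ d₁ r₂ d₂} → (∀ n → Π r₂ d₂ a n ≤ Π r₁ d₁ a n) → EntropyDensityGeq a r₁ d₁ r₂ d₂
EntropyDensityGeq-of-≤ a {r₁} {d₁} Π₂≤Π₁ k = 0 , λ n _ →
  ≤-trans (^-monoˡ-≤ (suc k) (Π₂≤Π₁ n)) (m≤m*n (Π r₁ d₁ a n ^ suc k) (2 ^ (n C 2)) {{m^n≢0 2 (n C 2)}})

EntropyDensityGeq-mono : ∀ a {r₁ d₁ r₂ d₂ r₁′ d₁′ r₂′ d₂′} →
  (∀ n → Π r₁ d₁ a n ≤ Π r₁′ d₁′ a n) → (∀ n → Π r₂′ d₂′ a n ≤ Π r₂ d₂ a n) →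
  EntropyDensityGeq a r₁ d₁ r₂ d₂ → EntropyDensityGeq a r₁′ d₁′ r₂′ d₂′
EntropyDensityGeq-mono a {r₁} {d₁} {r₂} {d₂} {r₁′} {d₁′} {r₂′} {d₂′} Π₁≤Π₁′ Π₂′≤Π₂ geq k =
  Product.map₂ (λ eventually n n₀≤n → begin
    Π r₂′ d₂′ a n ^ suc k               ≤⟨ ^-monoˡ-≤ (suc k) (Π₂′≤Π₂ n) ⟩
    Π r₂ d₂ a n ^ suc k                 ≤⟨ eventually n n₀≤n ⟩
    Π r₁ d₁ a n ^ suc k * 2 ^ (n C 2)   ≤⟨ *-monoˡ-≤ (2 ^ (n C 2)) (^-monoˡ-≤ (suc k) (Π₁≤Π₁′ n)) ⟩
    Π r₁′ d₁′ a n ^ suc k * 2 ^ (n C 2) ∎) (geq k)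
  where open ≤-Reasoning

record Gap (K T x y : ℕ) : Set where
  constructor mkGap
  field
    x^K*2^T<y^K : x ^ K * 2 ^ T < y ^ K

Gap-monoˡ : ∀ {K T x x′ y} → x′ ≤ x → Gap K T x y → Gap K T x′ y
Gap-monoˡ {K} {T} x′≤x (mkGap gap) = mkGap (≤-<-trans (*-monoˡ-≤ (2 ^ T) (^-monoˡ-≤ K x′≤x)) gap)

Gap-monoʳ : ∀ {K T x y y′} → y ≤ y′ → Gap K T x y → Gap K T x y′
Gap-monoʳ {K} y≤y′ (mkGap gap) = mkGap (<-≤-trans gap (^-monoˡ-≤ K y≤y′))

Gap-transfer : ∀ {K T x y u v} N z .{{_ : NonZero N}} →
  x * z ≤ N * u → N * v ≤ y * z → Gap K T u v → Gap K T x y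
Gap-transfer {K} {T} {x} {y} {u} {v} N z xz≤Nu Nv≤yz (mkGap gap) =
  mkGap (*-cancelʳ-< (z ^ K) (x ^ K * 2 ^ T) (y ^ K) (begin-strict
    x ^ K * 2 ^ T * z ^ K       ≡⟨ shuffle (x ^ K) (2 ^ T) (z ^ K) ⟩
    x ^ K * z ^ K * 2 ^ T       ≡⟨ cong (_* 2 ^ T) (^-distribʳ-* x z K) ⟨
    (x * z) ^ K * 2 ^ T         ≤⟨ *-monoˡ-≤ (2 ^ T) (^-monoˡ-≤ K xz≤Nu) ⟩
    (N * u) ^ K * 2 ^ T         ≡⟨ trans (cong (_* 2 ^ T) (^-distribʳ-* N u K)) (*-assoc (N ^ K) (u ^ K) (2 ^ T)) ⟩
    N ^ K * (u ^ K * 2 ^ T)     <⟨ *-monoʳ-< (N ^ K) {{m^n≢0 N K}} gap ⟩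
    N ^ K * v ^ K               ≡⟨ ^-distribʳ-* N v K ⟨
    (N * v) ^ K                 ≤⟨ ^-monoˡ-≤ K Nv≤yz ⟩
    (y * z) ^ K                 ≡⟨ ^-distribʳ-* y z K ⟩
    y ^ K * z ^ K               ∎))
  where
  open ≤-Reasoning
  shuffle : ∀ x y z → x * y * z ≡ x * z * y
  shuffle = solve-∀

Gap-pow : ∀ {a c K T} e f → 1 ≤ a → c ≤ a → a * (suc T + a * (f * K)) ≤ e * K →
  Gap K T (c ^ e * suc c ^ f) (suc c ^ e)
Gap-pow {a} {c} {K} {T} e f 1≤a c≤a bound = mkGap (begin-strict
  (c ^ e * suc c ^ f) ^ K * 2 ^ T       ≡⟨ cong (_* 2 ^ T) (trans (^-distribʳ-* (c ^ e) (suc c ^ f) K)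
                                                                (cong₂ _*_ (^-*-assoc c e K) (^-*-assoc (suc c) f K))) ⟩
  c ^ (e * K) * suc c ^ (f * K) * 2 ^ T <⟨ exponential-gap 1≤a c≤a bound ⟩
  suc c ^ (e * K)                       ≡⟨ ^-*-assoc (suc c) e K ⟨
  (suc c ^ e) ^ K                       ∎)
  where open ≤-Reasoning

module StrictGap (a R d : ℕ) .{{_ : NonZero a}} (d<a : d < a) where

  private
    Y c : ℕ
    Y = suc a
    c = a ∸ suc d

    1≤a : 1 ≤ a
    1≤a = >-nonZero⁻¹ a

    c≤a : c ≤ a
    c≤a = m∸n≤m a (suc d)

    1+c≡a∸d : suc c ≡ a ∸ d
    1+c≡a∸d = sym (+-∸-assoc 1 d<a)

    Y^T*a^k≢0 : ∀ T k → NonZero (Y ^ T * a ^ k)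
    Y^T*a^k≢0 T k = m*n≢0 (Y ^ T) (a ^ k) {{m^n≢0 Y T}} {{m^n≢0 a k}}

  -- n = L · m below, and K₀ is chosen so that a · (C₂ n + 1) ≤ K₀ · C₂ m once m ≥ 2.
  L K₀ : ℕ
  L  = 2 + R * (1 + 2 * (a * a))
  K₀ = 4 * a * (L * L)

  module _ (m : ℕ) where

    q n T : ℕ
    q = (1 + 2 * (a * a)) * m
    n = 2 * m + R * q
    T = C₂ n

    m≤n : m ≤ n
    m≤n = ≤-trans (m≤m+n m (m + 0)) (m≤m+n (2 * m) (R * q))

    g : Vec (Fin (suc R)) n
    g = balanced R (2 * m) q

    tg Ag : ℕ
    tg = C₂ (2 * m)
    Ag = R * C₂ q

    insidePairs⁺-excess : (f : Vec (Fin (suc R)) n) → size f zero < m → Ag + q * m ≤ insidePairs⁺ f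
    insidePairs⁺-excess f s₀<m = +-cancelʳ-≤ (R * (q * q)) (Ag + q * m) (insidePairs⁺ f) (begin
      Ag + q * m + R * (q * q)     ≡⟨ expand (C₂ q) q m R ⟩
      Ag + q * (m + R * q)         ≤⟨ +-monoʳ-≤ Ag (*-monoʳ-≤ q m+R*q≤S) ⟩
      Ag + q * S                   ≤⟨ ∑-C₂-tangent q (size f ∘ suc) ⟩
      insidePairs⁺ f + R * (q * q) ∎)
      where
      open ≤-Reasoning
      S : ℕ
      S = ∑[ i < R ] size f (suc i)
      expand : ∀ c q m R → R * c + q * m + R * (q * q) ≡ R * c + q * (m + R * q)
      expand = solve-∀
      m+R*q≤S : m + R * q ≤ S
      m+R*q≤S = +-cancelˡ-≤ m (m + R * q) S (begin
        m + (m + R * q) ≡⟨ +-assoc m m (R * q) ⟨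
        m + m + R * q   ≡⟨ cong (λ x → m + x + R * q) (+-identityʳ m) ⟨
        2 * m + R * q   ≡⟨ ∑-size f ⟨
        size f zero + S ≤⟨ +-monoˡ-≤ S (<⇒≤ s₀<m) ⟩
        m + S           ∎)

    Pf-upper : ∀ (f : Vec (Fin (suc R)) n) Δ → insidePairs⁺ f ≡ Ag + Δ →
      Pf a (suc d) f * Y ^ (tg + (Ag + Δ)) ≤ Y ^ T * a ^ Ag * (a ^ Δ * Y ^ tg)
    Pf-upper f Δ A≡Ag+Δ = begin
      Pf a (suc d) f * Y ^ (tg + (Ag + Δ))   ≡⟨ cong (Pf a (suc d) f *_) (^-distribˡ-+-* Y tg (Ag + Δ)) ⟩
      Pf a (suc d) f * (Y ^ tg * Y ^ (Ag + Δ)) ≡⟨ x*[y*z]≡x*z*y (Pf a (suc d) f) (Y ^ tg) (Y ^ (Ag + Δ)) ⟩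
      Pf a (suc d) f * Y ^ (Ag + Δ) * Y ^ tg ≤⟨ *-monoˡ-≤ (Y ^ tg) (subst (λ A → Pf a (suc d) f * Y ^ A ≤ Y ^ T * a ^ A)
                                                                        A≡Ag+Δ (P-upper a (suc d) f)) ⟩
      Y ^ T * a ^ (Ag + Δ) * Y ^ tg          ≡⟨ cong (λ x → Y ^ T * x * Y ^ tg) (^-distribˡ-+-* a Ag Δ) ⟩
      Y ^ T * (a ^ Ag * a ^ Δ) * Y ^ tg      ≡⟨ regroup (Y ^ T) (a ^ Ag) (a ^ Δ) (Y ^ tg) ⟩
      Y ^ T * a ^ Ag * (a ^ Δ * Y ^ tg)      ∎
      where
      open ≤-Reasoning
      x*[y*z]≡x*z*y : ∀ x y z → x * (y * z) ≡ x * z * y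
      x*[y*z]≡x*z*y = solve-∀
      regroup : ∀ x y z w → x * (y * z) * w ≡ x * y * (z * w)
      regroup = solve-∀

    Pf-balanced-lower : ∀ Δ → Y ^ T * a ^ Ag * Y ^ Δ ≤ Pf a d g * Y ^ (tg + (Ag + Δ))
    Pf-balanced-lower Δ = begin
      Y ^ T * a ^ Ag * Y ^ Δ               ≡⟨ cong (λ e → Y ^ T * a ^ e * Y ^ Δ) (insidePairs⁺-balanced R (2 * m) q) ⟨
      Y ^ T * a ^ insidePairs⁺ g * Y ^ Δ   ≤⟨ *-monoˡ-≤ (Y ^ Δ) (P-lower a d d<a g) ⟩
      Pf a d g * Y ^ insidePairs g * Y ^ Δ ≡⟨ cong (λ e → Pf a d g * Y ^ e * Y ^ Δ) insidePairs-g ⟩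
      Pf a d g * Y ^ (tg + Ag) * Y ^ Δ     ≡⟨ *-assoc (Pf a d g) _ _ ⟩
      Pf a d g * (Y ^ (tg + Ag) * Y ^ Δ)   ≡⟨ cong (Pf a d g *_) (^-distribˡ-+-* Y (tg + Ag) Δ) ⟨
      Pf a d g * Y ^ (tg + Ag + Δ)         ≡⟨ cong (λ e → Pf a d g * Y ^ e) (+-assoc tg Ag Δ) ⟩
      Pf a d g * Y ^ (tg + (Ag + Δ))       ∎
      where
      open ≤-Reasoning
      insidePairs-g : insidePairs g ≡ tg + Ag
      insidePairs-g = cong₂ _+_ (cong C₂ (size-balanced-zero R (2 * m) q)) (insidePairs⁺-balanced R (2 * m) q)

    module _ (2≤m : 2 ≤ m) {K : ℕ} (K₀≤K : K₀ ≤ K) where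

      a*[1+T]≤K*C₂m : a * suc T ≤ K * C₂ m
      a*[1+T]≤K*C₂m = begin
        a * suc T                ≤⟨ *-monoʳ-≤ a (C₂<n*n (≤-trans (≤-trans (s≤s z≤n) 2≤m) m≤n)) ⟩
        a * (n * n)              ≡⟨ cong (λ x → a * (x * x)) (n≡L*m a R m) ⟩
        a * (L * m * (L * m))    ≡⟨ regroup a L m ⟩
        a * (L * L) * (m * m)    ≤⟨ *-monoʳ-≤ (a * (L * L)) (n*n≤4*C₂ 2≤m) ⟩
        a * (L * L) * (4 * C₂ m) ≡⟨ regroup′ a (L * L) (C₂ m) ⟩
        K₀ * C₂ m                ≤⟨ *-monoˡ-≤ (C₂ m) K₀≤K ⟩
        K * C₂ m                 ∎
        where
        open ≤-Reasoning
        n≡L*m : ∀ a R m → 2 * m + R * ((1 + 2 * (a * a)) * m) ≡ (2 + R * (1 + 2 * (a * a))) * m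
        n≡L*m = solve-∀
        regroup : ∀ a L m → a * (L * m * (L * m)) ≡ a * (L * L) * (m * m)
        regroup = solve-∀
        regroup′ : ∀ a x t → a * x * (4 * t) ≡ 4 * a * x * t
        regroup′ = solve-∀

      large-part : (f : Vec (Fin (suc R)) n) → m ≤ size f zero → Gap K T (Pf a (suc d) f) (Pf a d f)
      large-part f m≤s₀ = Gap-transfer (Y ^ T * a ^ A) (Y ^ insidePairs f) {{Y^T*a^k≢0 T A}}
        (≤-reflexive (trans (P-formula a (suc d) f) (swap (Y ^ T) (c ^ t) (a ^ A))))
        (≤-reflexive (trans (cong (λ b → Y ^ T * a ^ A * b ^ t) 1+c≡a∸d)
                            (trans (sym (swap (Y ^ T) ((a ∸ d) ^ t) (a ^ A))) (sym (P-formula a d f)))))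
        (Gap-monoˡ (≤-reflexive (sym (*-identityʳ (c ^ t)))) (Gap-pow t 0 1≤a c≤a bound))
        where
        t A : ℕ
        t = C₂ (size f zero)
        A = insidePairs⁺ f
        swap : ∀ x y z → x * (y * z) ≡ x * z * y
        swap = solve-∀
        bound : a * (suc T + a * 0) ≤ t * K
        bound = begin
          a * (suc T + a * 0) ≡⟨ cong (λ x → a * (suc T + x)) (*-zeroʳ a) ⟩
          a * (suc T + 0)     ≡⟨ cong (a *_) (+-identityʳ (suc T)) ⟩
          a * suc T           ≤⟨ a*[1+T]≤K*C₂m ⟩
          K * C₂ m            ≤⟨ *-monoʳ-≤ K (C₂-mono m≤s₀) ⟩
          K * t               ≡⟨ *-comm K t ⟩
          t * K               ∎
          where open ≤-Reasoning

      small-part-bound : ∀ {Δ} → q * m ≤ Δ → a * (suc T + a * (tg * K)) ≤ Δ * K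
      small-part-bound {Δ} q*m≤Δ = begin
        a * (suc T + a * (tg * K))                ≡⟨ *-distribˡ-+ a (suc T) (a * (tg * K)) ⟩
        a * suc T + a * (a * (tg * K))            ≤⟨ +-mono-≤ (≤-trans a*[1+T]≤K*C₂m (*-monoʳ-≤ K (C₂≤n*n m)))
                                                              (*-monoʳ-≤ a (*-monoʳ-≤ a (*-monoˡ-≤ K (C₂[2*n]≤2*[n*n] m)))) ⟩
        K * (m * m) + a * (a * (2 * (m * m) * K)) ≡⟨ collect K a m ⟩
        q * m * K                                 ≤⟨ *-monoˡ-≤ K q*m≤Δ ⟩
        Δ * K                                     ∎
        where
        open ≤-Reasoning
        collect : ∀ K a m → K * (m * m) + a * (a * (2 * (m * m) * K)) ≡ (1 + 2 * (a * a)) * m * m * K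
        collect = solve-∀

      small-part : (f : Vec (Fin (suc R)) n) → size f zero < m → Gap K T (Pf a (suc d) f) (Pf a d g)
      small-part f s₀<m = Gap-transfer (Y ^ T * a ^ Ag) (Y ^ (tg + (Ag + Δ))) {{Y^T*a^k≢0 T Ag}}
        (Pf-upper f Δ A≡Ag+Δ) (Pf-balanced-lower Δ) (Gap-pow Δ tg 1≤a ≤-refl (small-part-bound q*m≤Δ))
        where
        excess : Ag + q * m ≤ insidePairs⁺ f
        excess = insidePairs⁺-excess f s₀<m
        Δ : ℕ
        Δ = insidePairs⁺ f ∸ Ag
        A≡Ag+Δ : insidePairs⁺ f ≡ Ag + Δ
        A≡Ag+Δ = sym (m+[n∸m]≡n (≤-trans (m≤m+n Ag (q * m)) excess))
        q*m≤Δ : q * m ≤ Δ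
        q*m≤Δ = +-cancelˡ-≤ Ag (q * m) Δ (≤-trans excess (≤-reflexive A≡Ag+Δ))

      Gap-Π : Gap K T (Π (suc R) (suc d) a n) (Π (suc R) d a n)
      Gap-Π = Π-induction a (suc d) (suc R) n (λ v → Gap K T v (Π (suc R) d a n)) (Gap-monoˡ z≤n (Gap-at g)) Gap-at
        where
        Gap-at : ∀ f → Gap K T (Pf a (suc d) f) (Π (suc R) d a n)
        Gap-at f with m ≤? size f zero
        ... | yes m≤s₀ = Gap-monoʳ (Pf≤Π a d f) (large-part f m≤s₀)
        ... | no  m≰s₀ = Gap-monoʳ (Pf≤Π a d g) (small-part f (≰⇒> m≰s₀))

¬EntropyDensityGeq-suc-d : ∀ a R d .{{_ : NonZero a}} → d < a → ¬ EntropyDensityGeq a (suc R) (suc d) (suc R) d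
¬EntropyDensityGeq-suc-d a R d d<a geq with geq K₀
  where open StrictGap a R d d<a using (K₀)
... | n₀ , eventually = <⇒≱ strict (eventually (n m) (≤-trans (m≤m+n n₀ 2) (m≤n m)))
  where
  open StrictGap a R d d<a
  m : ℕ
  m = n₀ + 2
  strict : Π (suc R) (suc d) a (n m) ^ suc K₀ * 2 ^ (n m C 2) < Π (suc R) d a (n m) ^ suc K₀
  strict = subst (λ T → Π (suc R) (suc d) a (n m) ^ suc K₀ * 2 ^ T < Π (suc R) d a (n m) ^ suc K₀) (C₂≡C2 (n m))
                 (Gap.x^K*2^T<y^K (Gap-Π m (m≤n+m 2 n₀) (n≤1+n K₀)))

proposition3p3 : (a r₁ r₂ d₁ d₂ : ℕ) → 1 ≤ a → 1 ≤ r₁ → 1 ≤ r₂ → d₁ < a → d₂ < a →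
    EntropyDensityGeq a r₁ d₁ r₂ d₂ ⇔ (r₂ < r₁ ⊎ (r₁ ≡ r₂ × d₁ ≤ d₂))
proposition3p3 a@(suc a′) r₁@(suc R₁) r₂ d₁ d₂ _ _ _ _ d₂<a =
  mk⇔ order-of-geq (λ order → EntropyDensityGeq-of-≤ a (λ n → Π-mono-order a n order))
  where
  order-of-geq : EntropyDensityGeq a r₁ d₁ r₂ d₂ → r₂ < r₁ ⊎ (r₁ ≡ r₂ × d₁ ≤ d₂)
  order-of-geq geq with <-cmp r₁ r₂
  ... | tri> _ _ r₂<r₁ = inj₁ r₂<r₁
  ... | tri< r₁<r₂ _ _ = ⊥-elim (¬EntropyDensityGeq-suc-d a r₁ a′ ≤-refl (EntropyDensityGeq-mono a
          (λ n → ≤-trans (Π-antitone-d a r₁ n z≤n) (Π-shift a a r₁ n))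
          (λ n → ≤-trans (Π-mono-r a a′ n r₁<r₂) (Π-antitone-d a r₂ n (≤-pred d₂<a)))
          geq))
  ... | tri≈ _ refl _ with d₁ ≤? d₂
  ...   | yes d₁≤d₂ = inj₂ (refl , d₁≤d₂)
  ...   | no  d₁≰d₂ = ⊥-elim (¬EntropyDensityGeq-suc-d a R₁ d₂ d₂<a (EntropyDensityGeq-mono a
          (λ n → Π-antitone-d a r₁ n (≰⇒> d₁≰d₂))
          (λ _ → ≤-refl)
          geq))
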